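{- Let $\tau:\mathbb{N}_0\to\mathbb{N}_0$ be an involution ($\tau(\tau(i))=i$ for all $i$) such that for all $i,j\in\mathbb{N}_0$, $\tau(i)-i=\tau(j)-j$ implies $i=j$. Let $U_\tau=\{i\in\mathbb{N}_0\mid\tau(i)\ge i\}$ and $\Phi=\frac{1+\sqrt5}{2}$. Then the set $$\{i\in U_\tau\mid \tau(i)\ge \Phi\, i\}$$ is infinite. -}

module Defs where

open import Data.Nat using (ℕ; _+_; _*_; _∸_; _≤_)
open import Data.Integer using (ℤ; +_; _-_)
open import Data.Product using (_×_; ∃-syntax)
open import Relation.Binary.PropositionalEquality using (_≡_)

IsInvolution : (ℕ → ℕ) → Set
IsInvolution τ = ∀ i → τ (τ i) ≡ i

DisplacementInjective : (ℕ → ℕ) → Set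
DisplacementInjective τ = ∀ i j → (+ τ i - + i) ≡ (+ τ j - + j) → i ≡ j

_∈U[_] : ℕ → (ℕ → ℕ) → Set
i ∈U[ τ ] = i ≤ τ i

-- "t ≥ Φ · i" where Φ = (1 + √5)/2, written without reals:
-- t ≥ ((1+√5)/2) i  ⇔  2t - i ≥ √5 · i  ⇔  2t ≥ i  and  (2t - i)² ≥ 5 i²
-- (all quantities are natural numbers, so √5 · i ≥ 0).
GeqPhiTimes : ℕ → ℕ → Set
GeqPhiTimes t i = (i ≤ 2 * t) × (5 * (i * i) ≤ (2 * t ∸ i) * (2 * t ∸ i))

InfinitelyMany : (ℕ → Set) → Set
InfinitelyMany P = ∀ n → ∃[ i ] (n ≤ i × P i)

-- Write d ≺ a for d < a/Φ. If no i in a window [n, x], x large, were a golden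
-- ascent, then every ascent i ≤ x (i ≤ τ i) would have displacement τ i − i ≺ x,
-- i.e. below x/Φ, while every descent i ≤ x would have displacement e = i − τ i
-- with e ≺ x − e, i.e. x − e above x/Φ. Sending ascents to their displacement and
-- descents to x minus theirs is injective by the displacement injectivity of τ
-- and the separation at x/Φ, yet maps the x + 1 points of [0, x] into [0, x).
module Submission where

open import Defs
open import Data.Nat using (ℕ; zero; suc; _+_; _*_; _∸_; _≤_; _<_; _≤?_; s≤s)
open import Data.Nat.Properties
open import Data.Nat.Tactic.RingSolver using (solve-∀)
open import Data.Integer using (+_) renaming (_-_ to _-ℤ_)
open import Data.Integer.Properties using ([+m]-[+n]≡m⊖n; ⊖-≥)
open import Data.Fin using (fromℕ<)
open import Data.Fin.Properties using (pigeonhole; fromℕ<-injective; toℕ≤pred[n])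
open import Data.Product using (_×_; _,_; ∃-syntax)
open import Data.Sum using (_⊎_; inj₁; inj₂)
open import Data.Empty using (⊥; ⊥-elim)
open import Function using (_∘_)
open import Relation.Nullary using (¬_; Dec; yes; no)
open import Relation.Nullary.Decidable using (_×-dec_)
open import Relation.Binary.PropositionalEquality

-- Dividing by a², d ≺ a reads (d/a)² + d/a < 1, that is d/a < 1/Φ.
infix 4 _≺_
_≺_ : ℕ → ℕ → Set
d ≺ a = d * d + a * d < a * a

≺⇒< : ∀ {d a} → d ≺ a → d < a
≺⇒< {d} {a} d≺a = ≰⇒> λ a≤d → <⇒≱ d≺a (≤-trans (*-mono-≤ a≤d a≤d) (m≤m+n (d * d) (a * d)))

≺-monoʳ-≤ : ∀ {d a b} → d ≺ a → a ≤ b → d ≺ b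
≺-monoʳ-≤ {d} {a} d≺a a≤b = subst (d ≺_) (m+[n∸m]≡n a≤b) (≺-+ (_ ∸ a))
  where
  expand : ∀ d a k → d * d + (a + k) * d ≡ (d * d + a * d) + k * d
  expand = solve-∀
  square : ∀ a k → (a + k) * (a + k) ≡ a * a + k * (a + a + k)
  square = solve-∀
  ≺-+ : ∀ k → d ≺ a + k
  ≺-+ k = subst₂ _<_ (sym (expand d a k)) (sym (square a k))
    (+-mono-<-≤ d≺a (*-monoʳ-≤ k (≤-trans (<⇒≤ (≺⇒< d≺a)) (≤-trans (m≤m+n a a) (m≤m+n (a + a) k)))))

2*d<⇒≺ : ∀ d {a} → 2 * d < a → d ≺ a
2*d<⇒≺ d 2d<a = ≺-monoʳ-≤ (subst (d * d + suc (2 * d) * d <_) (sym (square d)) (s≤s (m≤m+n _ _))) 2d<a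
  where
  square : ∀ d → suc (2 * d) * suc (2 * d) ≡ suc ((d * d + suc (2 * d) * d) + (d * d + 3 * d))
  square = solve-∀

-- Φ d < d + e by the first hypothesis, but d + e < Φ d by the second since 1/Φ = Φ − 1;
-- summing the two inequalities gives the identity below with < in place of ≡.
≺-golden-split : ∀ d e → d ≺ d + e → ¬ (e ≺ d)
≺-golden-split d e d≺d+e e≺d = <-irrefl (identity d e) (+-mono-< d≺d+e e≺d)
  where
  identity : ∀ d e → d * d + (d + e) * d + (e * e + d * e) ≡ (d + e) * (d + e) + d * d
  identity = solve-∀

-- With t = i + d, failing t ≥ Φ i means (i + 2d)² < 5 i², that is d² + i d < i².
¬GeqPhiTimes⇒≺ : ∀ {i t} → i ≤ t → ¬ GeqPhiTimes t i → t ∸ i ≺ i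
¬GeqPhiTimes⇒≺ {i} {t} i≤t ¬geq with t ∸ i | m+[n∸m]≡n i≤t
... | d | refl = *-cancelˡ-< 4 _ _ (+-cancelˡ-< (i * i) _ _ (subst₂ _<_ lhs (five-squares i) (≰⇒> (¬geq ∘ (i≤2t ,_)))))
  where
  i≤2t : i ≤ 2 * (i + d)
  i≤2t = ≤-trans (m≤m+n i d) (m≤m+n (i + d) _)
  double : ∀ i d → 2 * (i + d) ≡ (i + (d + d)) + i
  double = solve-∀
  square : ∀ i d → (i + (d + d)) * (i + (d + d)) ≡ i * i + 4 * (d * d + i * d)
  square = solve-∀
  2t∸i : 2 * (i + d) ∸ i ≡ i + (d + d)
  2t∸i = trans (cong (_∸ i) (double i d)) (m+n∸n≡m (i + (d + d)) i)
  lhs : (2 * (i + d) ∸ i) * (2 * (i + d) ∸ i) ≡ i * i + 4 * (d * d + i * d)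
  lhs = trans (cong (λ z → z * z) 2t∸i) (square i d)
  five-squares : ∀ i → 5 * (i * i) ≡ i * i + 4 * (i * i)
  five-squares = solve-∀

bounded-on-< : (f : ℕ → ℕ) (n : ℕ) → ∃[ B ] (∀ {a} → a < n → f a ≤ B)
bounded-on-< f zero = 0 , λ ()
bounded-on-< f (suc n) with bounded-on-< f n
... | B , f≤B = f n + B , below
  where
  below : ∀ {a} → a < suc n → f a ≤ f n + B
  below a<1+n with m<1+n⇒m<n∨m≡n a<1+n
  ... | inj₁ a<n  = ≤-trans (f≤B a<n) (m≤n+m B (f n))
  ... | inj₂ refl = m≤m+n (f n) B

pigeonhole-≤-< : ∀ {x} (f : ℕ → ℕ) → (∀ {i} → i ≤ x → f i < x) →
                 ¬ (∀ {i j} → i ≤ x → j ≤ x → f i ≡ f j → i ≡ j)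
pigeonhole-≤-< {x} f f<x f-inj with pigeonhole (n<1+n x) (λ k → fromℕ< (f<x (toℕ≤pred[n] k)))
... | k , l , k<l , fk≡fl =
  <-irrefl (f-inj (toℕ≤pred[n] k) (toℕ≤pred[n] l) (fromℕ<-injective _ _ _ _ fk≡fl)) k<l

[+m]-[+n]≡+[m∸n] : ∀ {m n} → n ≤ m → + m -ℤ + n ≡ + (m ∸ n)
[+m]-[+n]≡+[m∸n] {m} {n} n≤m = trans ([+m]-[+n]≡m⊖n m n) (⊖-≥ n≤m)

GoldenAscent : (ℕ → ℕ) → ℕ → Set
GoldenAscent τ i = (i ∈U[ τ ]) × GeqPhiTimes (τ i) i

golden-ascent? : ∀ τ i → Dec (GoldenAscent τ i)
golden-ascent? τ i = i ≤? τ i ×-dec (i ≤? 2 * τ i ×-dec 5 * (i * i) ≤? (2 * τ i ∸ i) * (2 * τ i ∸ i))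

module _ {τ : ℕ → ℕ} (τ-invol : IsInvolution τ) (τ-disp-inj : DisplacementInjective τ) where

  ascent-injective : ∀ {i j} → i ≤ τ i → j ≤ τ j → τ i ∸ i ≡ τ j ∸ j → i ≡ j
  ascent-injective {i} {j} i≤τi j≤τj eq = τ-disp-inj i j (begin
    + τ i -ℤ + i  ≡⟨ [+m]-[+n]≡+[m∸n] i≤τi ⟩
    + (τ i ∸ i)   ≡⟨ cong +_ eq ⟩
    + (τ j ∸ j)   ≡⟨ [+m]-[+n]≡+[m∸n] j≤τj ⟨
    + τ j -ℤ + j  ∎)
    where open ≡-Reasoning

  ascent-of-descent : ∀ {i} → τ i ≤ i → τ i ≤ τ (τ i)
  ascent-of-descent {i} = subst (τ i ≤_) (sym (τ-invol i))

  descent-injective : ∀ {i j} → τ i ≤ i → τ j ≤ j → i ∸ τ i ≡ j ∸ τ j → i ≡ j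
  descent-injective {i} {j} τi≤i τj≤j eq = begin
    i        ≡⟨ τ-invol i ⟨
    τ (τ i)  ≡⟨ cong τ (ascent-injective (ascent-of-descent τi≤i) (ascent-of-descent τj≤j) eq′) ⟩
    τ (τ j)  ≡⟨ τ-invol j ⟩
    j        ∎
    where
    open ≡-Reasoning
    eq′ : τ (τ i) ∸ τ i ≡ τ (τ j) ∸ τ j
    eq′ = subst₂ (λ a b → a ∸ τ i ≡ b ∸ τ j) (sym (τ-invol i)) (sym (τ-invol j)) eq

  -- With B bounding τ on [0, n), x = 3B + 1 makes every e ≤ B satisfy e ≺ x − e.
  module GoldenAscentFree (n B : ℕ) (τ-bounded : ∀ {a} → a < n → τ a ≤ B)
    (free : ∀ {i} → n ≤ i → i ≤ suc (3 * B) → ¬ GoldenAscent τ i) where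

    x : ℕ
    x = suc (3 * B)

    small-≺ : ∀ {d} → d ≤ B → d ≺ x ∸ d
    small-≺ {d} d≤B = 2*d<⇒≺ d (m+n≤o⇒m≤o∸n (suc (2 * d)) (s≤s (subst (_≤ 3 * B) (triple d) (*-monoʳ-≤ 3 d≤B))))
      where
      triple : ∀ d → 3 * d ≡ 2 * d + d
      triple = solve-∀

    ascent-≺-or-small : ∀ {a} → a ≤ x → a ≤ τ a → τ a ∸ a ≺ a ⊎ τ a ∸ a ≤ B
    ascent-≺-or-small {a} a≤x a≤τa with n ≤? a
    ... | yes n≤a = inj₁ (¬GeqPhiTimes⇒≺ a≤τa (λ geq → free n≤a a≤x (a≤τa , geq)))
    ... | no  n≰a = inj₂ (≤-trans (m∸n≤m (τ a) a) (τ-bounded (≰⇒> n≰a)))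

    ascent-≺ : ∀ {a} → a ≤ x → a ≤ τ a → τ a ∸ a ≺ x
    ascent-≺ {a} a≤x a≤τa with ascent-≺-or-small a≤x a≤τa
    ... | inj₁ d≺a = ≺-monoʳ-≤ d≺a a≤x
    ... | inj₂ d≤B = ≺-monoʳ-≤ (small-≺ d≤B) (m∸n≤m x (τ a ∸ a))

    ascent-≺-complement : ∀ {a} → a ≤ τ a → τ a ≤ x → τ a ∸ a ≺ x ∸ (τ a ∸ a)
    ascent-≺-complement {a} a≤τa τa≤x with ascent-≺-or-small (≤-trans a≤τa τa≤x) a≤τa
    ... | inj₁ d≺a = ≺-monoʳ-≤ d≺a (m+n≤o⇒m≤o∸n a (subst (_≤ x) (sym (m+[n∸m]≡n a≤τa)) τa≤x))
    ... | inj₂ d≤B = small-≺ d≤B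

    descent-≺ : ∀ {i} → τ i < i → i ≤ x → i ∸ τ i ≺ x ∸ (i ∸ τ i)
    descent-≺ {i} τi<i i≤x = subst (λ t → t ∸ τ i ≺ x ∸ (t ∸ τ i)) (τ-invol i)
      (ascent-≺-complement (ascent-of-descent (<⇒≤ τi<i)) (subst (_≤ x) (sym (τ-invol i)) i≤x))

    ascent-displacement≢descent-slot : ∀ {i j} → i ≤ x → i ≤ τ i → j ≤ x → τ j < j →
                                       τ i ∸ i ≢ x ∸ (j ∸ τ j)
    ascent-displacement≢descent-slot {i} {j} i≤x i≤τi j≤x τj<j eq =
      ≺-golden-split (τ i ∸ i) e (subst (τ i ∸ i ≺_) x≡d+e (ascent-≺ i≤x i≤τi))
                                 (subst (e ≺_) (sym eq) (descent-≺ τj<j j≤x))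
      where
      e : ℕ
      e = j ∸ τ j
      x≡d+e : x ≡ τ i ∸ i + e
      x≡d+e = trans (sym (m∸n+n≡m (≤-trans (m∸n≤m j (τ j)) j≤x))) (cong (_+ e) (sym eq))

    slot : ℕ → ℕ
    slot i with i ≤? τ i
    ... | yes _ = τ i ∸ i
    ... | no  _ = x ∸ (i ∸ τ i)

    slot-< : ∀ {i} → i ≤ x → slot i < x
    slot-< {i} i≤x with i ≤? τ i
    ... | yes i≤τi = ≺⇒< (ascent-≺ i≤x i≤τi)
    ... | no  i≰τi = ∸-monoʳ-< (m<n⇒0<n∸m (≰⇒> i≰τi)) (≤-trans (m∸n≤m i (τ i)) i≤x)

    slot-injective : ∀ {i j} → i ≤ x → j ≤ x → slot i ≡ slot j → i ≡ j
    slot-injective {i} {j} i≤x j≤x eq with i ≤? τ i | j ≤? τ j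
    ... | yes i≤τi | yes j≤τj = ascent-injective i≤τi j≤τj eq
    ... | yes i≤τi | no  j≰τj = ⊥-elim (ascent-displacement≢descent-slot i≤x i≤τi j≤x (≰⇒> j≰τj) eq)
    ... | no  i≰τi | yes j≤τj = ⊥-elim (ascent-displacement≢descent-slot j≤x j≤τj i≤x (≰⇒> i≰τi) (sym eq))
    ... | no  i≰τi | no  j≰τj = descent-injective (≰⇒≥ i≰τi) (≰⇒≥ j≰τj)
      (∸-cancelˡ-≡ (≤-trans (m∸n≤m i (τ i)) i≤x) (≤-trans (m∸n≤m j (τ j)) j≤x) eq)

    impossible : ⊥
    impossible = pigeonhole-≤-< slot slot-< slot-injective

lemma3p3 : (τ : ℕ → ℕ) → IsInvolution τ → DisplacementInjective τ →
    InfinitelyMany (λ i → (i ∈U[ τ ]) × GeqPhiTimes (τ i) i)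
lemma3p3 τ τ-invol τ-disp-inj n with bounded-on-< τ n
... | B , τ-bounded with anyUpTo? (λ i → n ≤? i ×-dec golden-ascent? τ i) (suc (suc (3 * B)))
...   | yes (i , _ , n≤i , golden) = i , n≤i , golden
...   | no  none = ⊥-elim (GoldenAscentFree.impossible τ-invol τ-disp-inj n B τ-bounded
                             (λ n≤i i≤x golden → none (_ , s≤s i≤x , n≤i , golden)))
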